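{- Let $n\ge2$, $N=p_1\cdots p_n$ a product of distinct primes with $\deg P_N<N$, and fix $i\in[n]$. Let $k$ be an integer with $0<k<N_i$ such that $kN_i^{ -1}$ is not congruent modulo $p_i$ to $\sum_{j\in T}\langle p_j^{ -1}\rangle_{p_i}$ for any $T\subseteq[n]\setminus\{i\}$. Then the coefficient of $x^k$ in $P_N(x)$ is $0$.
   Context: For indices $i_1,\dots,i_m\in[n]$ write $N_{i_1\cdots i_m}=N/(p_{i_1}\cdots p_{i_m})$, and $P_N(x)=\frac{(1-x^N)\prod_{1\le i<j\le n}(1-x^{N_{ij}})}{\prod_{i=1}^n(1-x^{N_i})}$. $N_i^{ -1}$ denotes the inverse of $N_i$ modulo $p_i$. For a rational $c=a/b$ with $b$ coprime to $m$, $\langle c\rangle_m$ is the smallest nonnegative integer $k$ with $kb\equiv a\pmod m$. -}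

module Defs where

open import Data.Nat using (ℕ; zero; suc; _+_; _*_; _∸_; _≡ᵇ_)
open import Data.Nat.Divisibility using (_∣_; _∣?_)
open import Data.Integer as ℤ using (ℤ; +_; ∣_∣)
open import Data.Fin as Fin using (Fin; zero; suc)
open import Data.Bool using (Bool; true; false; if_then_else_; _∨_)
open import Relation.Nullary.Decidable using (does)

prodℕ : ∀ {n} → (Fin n → ℕ) → ℕ
prodℕ {zero} f = 1
prodℕ {suc n} f = f zero * prodℕ (λ j → f (suc j))

sumℕ : ∀ {n} → (Fin n → ℕ) → ℕ
sumℕ {zero} f = 0
sumℕ {suc n} f = f zero + sumℕ (λ j → f (suc j))

bigN : ∀ {n} → (Fin n → ℕ) → ℕ
bigN p = prodℕ p

-- N_i = N / p_i  (product of the p_j with j ≠ i)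
Nᵢ : ∀ {n} → (Fin n → ℕ) → Fin n → ℕ
Nᵢ p i = prodℕ (λ l → if does (l Fin.≟ i) then 1 else p l)

-- N_{ij} = N / (p_i p_j)  (for i ≠ j)
Nᵢⱼ : ∀ {n} → (Fin n → ℕ) → Fin n → Fin n → ℕ
Nᵢⱼ p i j = prodℕ (λ l → if does (l Fin.≟ i) ∨ does (l Fin.≟ j) then 1 else p l)

Cong : ℕ → ℕ → ℕ → Set
Cong m a b = m ∣ ∣ (+ a) ℤ.- (+ b) ∣

congᵇ : ℕ → ℕ → ℕ → Bool
congᵇ m a b = does (m ∣? ∣ (+ a) ℤ.- (+ b) ∣)

-- least k < m with P k (default m if none)
leastBelow : ℕ → (ℕ → Bool) → ℕ
leastBelow zero P = 0
leastBelow (suc m) P = if P 0 then 0 else suc (leastBelow m (λ k → P (suc k)))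

-- ⟨a/b⟩_m : least nonnegative k with k b ≡ a (mod m)  (exists in [0,m) when gcd(b,m)=1)
bracket : ℕ → ℕ → ℕ → ℕ
bracket a b m = leastBelow m (λ k → congᵇ m (k * b) a)

Series : Set
Series = ℕ → ℤ

sumUpTo : ℕ → (ℕ → ℤ) → ℤ
sumUpTo zero f = f 0
sumUpTo (suc k) f = sumUpTo k f ℤ.+ f (suc k)

_⊛_ : Series → Series → Series
(f ⊛ g) k = sumUpTo k (λ j → f j ℤ.* g (k ∸ j))

oneS : Series
oneS k = if k ≡ᵇ 0 then + 1 else + 0

oneMinusXPow : ℕ → Series
oneMinusXPow a k = oneS k ℤ.- (if k ≡ᵇ a then + 1 else + 0)

-- 1 / (1 - x^b) = Σ_t x^{bt}   (b > 0)
geomS : ℕ → Series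
geomS b k = if does (b ∣? k) then + 1 else + 0

prodS : ∀ {n} → (Fin n → Series) → Series
prodS {zero} f = oneS
prodS {suc n} f = f zero ⊛ prodS (λ j → f (suc j))

-- P_N(x) = (1-x^N) ∏_{i<j} (1-x^{N_ij}) / ∏_i (1-x^{N_i}), as a power series
PN : ∀ {n} → (Fin n → ℕ) → Series
PN p = oneMinusXPow (bigN p)
     ⊛ (prodS (λ i → prodS (λ j → if does (i Fin.<? j) then oneMinusXPow (Nᵢⱼ p i j) else oneS))
     ⊛ prodS (λ i → geomS (Nᵢ p i)))

{-# OPTIONS --safe #-}
-- Work modulo q = p_i with exponents m < N_i. Such an m is never N, so 1 - x^N contributes only 0;
-- 1/(1 - x^{N_l}) contributes multiples of N_l, which vanish mod q for l ≠ i, and only 0 for l = i;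
-- 1 - x^{N_ab} contributes 0 or N_ab, which vanishes mod q unless {a, b} = {i, j}, where it is N_ij.
-- Hence an exponent k < N_i with nonzero coefficient satisfies k ≡ Σ_{j ∈ T} N_ij (mod q) for some
-- set T ∌ i, each pair factor being used once. Multiplying by N_i⁻¹ and using N_i = p_j N_ij gives
-- k N_i⁻¹ ≡ Σ_{j ∈ T} p_j⁻¹ (mod q), which the hypothesis excludes.
module Submission where

open import Defs
open import Data.Nat using (ℕ; zero; suc; _+_; _*_; _∸_; _≤_; _<_; _≡ᵇ_; z≤n; s≤s; NonZero; ∣_-_∣)
open import Data.Nat.Properties hiding (_≟_; _<?_; <-irrefl; <-asym)
open import Data.Nat.DivMod using (_%_; _/_; %-distribˡ-+; %-distribˡ-*; %-remove-+ʳ; [m+kn]%n≡m%n; m*n%n≡0; m≡m%n+[m/n]*n; m%n<n; m%n%n≡m%n)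
open import Data.Nat.Divisibility using (_∣_; divides; _∣?_; n∣m⇒m%n≡0; ∣1⇒≡1; ∣-trans; >⇒∤)
open import Data.Nat.Primality using (Prime; euclidsLemma; prime⇒irreducible; prime⇒nonZero; ¬prime[0]; ¬prime[1])
open import Data.Nat.Coprimality using (Coprime; coprime-Bézout)
open import Data.Nat.GCD using (module Bézout)
open import Data.Nat.Solver using (module +-*-Solver)
open import Data.Integer as ℤ using (ℤ; +_)
import Data.Integer.Properties as ℤₚ
open import Data.Fin as Fin using (Fin; zero; suc; _<?_)
open import Data.Fin.Properties using (_≟_; <-irrefl; <-asym)
open import Data.Fin.Subset using (Subset; _∉_)
open import Data.Vec using (lookup; tabulate)
open import Data.Vec.Properties using (lookup∘tabulate; []=⇒lookup)
open import Data.Bool using (Bool; true; false; T; if_then_else_; _∨_)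
open import Data.Bool.Properties using (∨-comm)
open import Data.Unit using (tt)
open import Data.Empty using (⊥-elim)
open import Data.Product using (∃-syntax; _×_; _,_)
open import Data.Sum using (_⊎_; inj₁; inj₂)
open import Function using (_∘_)
open import Relation.Binary.PropositionalEquality
open import Relation.Nullary using (¬_; Dec; yes; no; does; ¬?; contradiction)
open import Relation.Nullary.Decidable using (dec-true; dec-false)
open import Algebra.Properties.Semiring.Sum +-*-semiring
  using (sum; sum-cong-≗; ∑-distrib-+; *-distribʳ-sum; sum-replicate-zero)
open import Algebra.Properties.CommutativeSemigroup *-commutativeSemigroup using (x∙yz≈y∙xz)

𝟙 : {P : Set} → Dec P → ℕ
𝟙 d = if does d then 1 else 0

𝟙-true : {P : Set} (d : Dec P) → P → 𝟙 d ≡ 1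
𝟙-true d x = cong (λ b → if b then 1 else 0) (dec-true d x)

𝟙-false : {P : Set} (d : Dec P) → ¬ P → 𝟙 d ≡ 0
𝟙-false d ¬x = cong (λ b → if b then 1 else 0) (dec-false d ¬x)

𝟙≤1 : {P : Set} (d : Dec P) → 𝟙 d ≤ 1
𝟙≤1 (yes _) = ≤-refl
𝟙≤1 (no _) = z≤n

𝟙-witness : {P : Set} (d : Dec P) → 1 ≤ 𝟙 d → P
𝟙-witness (yes x) _ = x

𝟙-* : {P : Set} (d : Dec P) (x : ℕ) → 𝟙 d * x ≡ (if does d then x else 0)
𝟙-* (yes _) x = +-identityʳ x
𝟙-* (no _) x = refl

sumℕ≡sum : ∀ {n} (f : Fin n → ℕ) → sumℕ f ≡ sum f
sumℕ≡sum {zero} f = refl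
sumℕ≡sum {suc n} f = cong (_+_ (f zero)) (sumℕ≡sum (f ∘ suc))

sum-δ : ∀ {n} (j : Fin n) (g : Fin n → ℕ) → sum (λ b → if does (b ≟ j) then g b else 0) ≡ g j
sum-δ {suc n} zero g = trans (cong (_+_ (g zero)) (sum-replicate-zero n)) (+-identityʳ (g zero))
sum-δ {suc n} (suc j) g = sum-δ j (g ∘ suc)

sum-δ-flip : ∀ {n} (j : Fin n) (g : Fin n → ℕ) → sum (λ b → if does (j ≟ b) then g b else 0) ≡ g j
sum-δ-flip {suc n} zero g = trans (cong (_+_ (g zero)) (sum-replicate-zero n)) (+-identityʳ (g zero))
sum-δ-flip {suc n} (suc j) g = sum-δ-flip j (g ∘ suc)

prodℕ-cong : ∀ {n} {f g : Fin n → ℕ} → (∀ l → f l ≡ g l) → prodℕ f ≡ prodℕ g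
prodℕ-cong {zero} f≗g = refl
prodℕ-cong {suc n} f≗g = cong₂ _*_ (f≗g zero) (prodℕ-cong (f≗g ∘ suc))

prodℕ-extract : ∀ {n} (f : Fin n → ℕ) (j : Fin n) →
  prodℕ f ≡ f j * prodℕ (λ l → if does (l ≟ j) then 1 else f l)
prodℕ-extract {suc n} f zero = cong (f zero *_) (sym (*-identityˡ _))
prodℕ-extract {suc n} f (suc j) = begin
  f zero * prodℕ (f ∘ suc)     ≡⟨ cong (f zero *_) (prodℕ-extract (f ∘ suc) j) ⟩
  f zero * (f (suc j) * rest)  ≡⟨ x∙yz≈y∙xz (f zero) (f (suc j)) rest ⟩
  f (suc j) * (f zero * rest)  ∎
  where
  open ≡-Reasoning
  rest = prodℕ (λ l → if does (l ≟ j) then 1 else f (suc l))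

factor∣prodℕ : ∀ {n} (f : Fin n → ℕ) (j : Fin n) → f j ∣ prodℕ f
factor∣prodℕ f j = divides (prodℕ (λ l → if does (l ≟ j) then 1 else f l)) (trans (prodℕ-extract f j) (*-comm (f j) _))

prime∣prodℕ : ∀ {n q} (f : Fin n → ℕ) → Prime q → q ∣ prodℕ f → ∃[ l ] q ∣ f l
prime∣prodℕ {zero} f q-prime q∣1 = contradiction (subst Prime (∣1⇒≡1 q∣1) q-prime) ¬prime[1]
prime∣prodℕ {suc n} f q-prime q∣f with euclidsLemma (f zero) (prodℕ (f ∘ suc)) q-prime q∣f
... | inj₁ q∣f₀ = zero , q∣f₀
... | inj₂ q∣rest with prime∣prodℕ (f ∘ suc) q-prime q∣rest
...   | l , q∣fₗ = suc l , q∣fₗ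

prime∣prime⇒≡ : ∀ {q r} → Prime q → Prime r → q ∣ r → q ≡ r
prime∣prime⇒≡ q-prime r-prime q∣r with prime⇒irreducible r-prime q∣r
... | inj₁ q≡1 = contradiction (subst Prime q≡1 q-prime) ¬prime[1]
... | inj₂ q≡r = q≡r

∣+a-+b∣≡∣a-b∣ : ∀ a b → ℤ.∣ + a ℤ.- + b ∣ ≡ ∣ a - b ∣
∣+a-+b∣≡∣a-b∣ a b with ≤-total a b
... | inj₁ a≤b = begin
  ℤ.∣ + a ℤ.- + b ∣  ≡⟨ cong ℤ.∣_∣ (ℤₚ.m-n≡m⊖n a b) ⟩
  ℤ.∣ a ℤ.⊖ b ∣      ≡⟨ ℤₚ.∣⊖∣-≤ a≤b ⟩
  b ∸ a              ≡⟨ m≤n⇒∣m-n∣≡n∸m a≤b ⟨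
  ∣ a - b ∣          ∎
  where open ≡-Reasoning
... | inj₂ b≤a = begin
  ℤ.∣ + a ℤ.- + b ∣  ≡⟨ cong ℤ.∣_∣ (ℤₚ.m-n≡m⊖n a b) ⟩
  ℤ.∣ a ℤ.⊖ b ∣      ≡⟨ ℤₚ.∣m⊖n∣≡∣n⊖m∣ a b ⟩
  ℤ.∣ b ℤ.⊖ a ∣      ≡⟨ ℤₚ.∣⊖∣-≤ b≤a ⟩
  a ∸ b              ≡⟨ m≤n⇒∣n-m∣≡n∸m b≤a ⟨
  ∣ a - b ∣          ∎
  where open ≡-Reasoning

module Residues (q : ℕ) .{{_ : NonZero q}} where

  infix 4 _≋_
  _≋_ : ℕ → ℕ → Set
  a ≋ b = a % q ≡ b % q

  ≋-+ : ∀ {a b c d} → a ≋ b → c ≋ d → a + c ≋ b + d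
  ≋-+ {a} {b} {c} {d} a≋b c≋d = begin
    (a + c) % q          ≡⟨ %-distribˡ-+ a c q ⟩
    (a % q + c % q) % q  ≡⟨ cong₂ (λ x y → (x + y) % q) a≋b c≋d ⟩
    (b % q + d % q) % q  ≡⟨ %-distribˡ-+ b d q ⟨
    (b + d) % q          ∎
    where open ≡-Reasoning

  ≋-* : ∀ {a b c d} → a ≋ b → c ≋ d → a * c ≋ b * d
  ≋-* {a} {b} {c} {d} a≋b c≋d = begin
    (a * c) % q            ≡⟨ %-distribˡ-* a c q ⟩
    (a % q * (c % q)) % q  ≡⟨ cong₂ (λ x y → (x * y) % q) a≋b c≋d ⟩
    (b % q * (d % q)) % q  ≡⟨ %-distribˡ-* b d q ⟨
    (b * d) % q            ∎
    where open ≡-Reasoning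

  ≋-sum : ∀ {n} {f g : Fin n → ℕ} → (∀ j → f j ≋ g j) → sum f ≋ sum g
  ≋-sum {zero} f≋g = refl
  ≋-sum {suc n} f≋g = ≋-+ (f≋g zero) (≋-sum (f≋g ∘ suc))

  ∣⇒≋0 : ∀ {a} → q ∣ a → a ≋ 0
  ∣⇒≋0 {a} q∣a = trans (n∣m⇒m%n≡0 a q q∣a) (sym (m*n%n≡0 0 q))

  ∣∸⇒≋ : ∀ {a b} → b ≤ a → q ∣ a ∸ b → a ≋ b
  ∣∸⇒≋ {a} {b} b≤a q∣a∸b = begin
    a % q              ≡⟨ cong (_% q) (m+[n∸m]≡n b≤a) ⟨
    (b + (a ∸ b)) % q  ≡⟨ %-remove-+ʳ b q∣a∸b ⟩
    b % q              ∎
    where open ≡-Reasoning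

  ≋⇒∣∸ : ∀ {a b} → b ≤ a → a ≋ b → q ∣ a ∸ b
  ≋⇒∣∸ {a} {b} b≤a a≋b = divides (a / q ∸ b / q) (begin
    a ∸ b                                      ≡⟨ cong₂ _∸_ (m≡m%n+[m/n]*n a q) (m≡m%n+[m/n]*n b q) ⟩
    (a % q + a / q * q) ∸ (b % q + b / q * q)  ≡⟨ cong (λ r → (a % q + a / q * q) ∸ (r + b / q * q)) a≋b ⟨
    (a % q + a / q * q) ∸ (a % q + b / q * q)  ≡⟨ [m+n]∸[m+o]≡n∸o (a % q) _ _ ⟩
    a / q * q ∸ b / q * q                      ≡⟨ *-distribʳ-∸ q (a / q) (b / q) ⟨
    (a / q ∸ b / q) * q                        ∎)
    where open ≡-Reasoning

  ∣∣a-b∣⇒≋ : ∀ {a b} → q ∣ ∣ a - b ∣ → a ≋ b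
  ∣∣a-b∣⇒≋ {a} {b} q∣∣a-b∣ with ≤-total b a
  ... | inj₁ b≤a = ∣∸⇒≋ b≤a (subst (q ∣_) (m≤n⇒∣n-m∣≡n∸m b≤a) q∣∣a-b∣)
  ... | inj₂ a≤b = sym (∣∸⇒≋ a≤b (subst (q ∣_) (m≤n⇒∣m-n∣≡n∸m a≤b) q∣∣a-b∣))

  ≋⇒∣∣a-b∣ : ∀ {a b} → a ≋ b → q ∣ ∣ a - b ∣
  ≋⇒∣∣a-b∣ {a} {b} a≋b with ≤-total b a
  ... | inj₁ b≤a = subst (q ∣_) (sym (m≤n⇒∣n-m∣≡n∸m b≤a)) (≋⇒∣∸ b≤a a≋b)
  ... | inj₂ a≤b = subst (q ∣_) (sym (m≤n⇒∣m-n∣≡n∸m a≤b)) (≋⇒∣∸ a≤b (sym a≋b))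

  Cong⇒≋ : ∀ {a b} → Cong q a b → a ≋ b
  Cong⇒≋ {a} {b} = ∣∣a-b∣⇒≋ ∘ subst (q ∣_) (∣+a-+b∣≡∣a-b∣ a b)

  ≋⇒Cong : ∀ {a b} → a ≋ b → Cong q a b
  ≋⇒Cong {a} {b} = subst (q ∣_) (sym (∣+a-+b∣≡∣a-b∣ a b)) ∘ ≋⇒∣∣a-b∣

inverse-mod : ∀ {q b} .{{_ : NonZero q}} → Prime q → ¬ q ∣ b → ∃[ x ] (x * b) % q ≡ 1 % q
inverse-mod {zero} q-prime _ = contradiction q-prime ¬prime[0]
inverse-mod {suc r} {b} q-prime q∤b with coprime-Bézout coprime
  where
  coprime : Coprime (suc r) b
  coprime (d∣q , d∣b) with prime⇒irreducible q-prime d∣q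
  ... | inj₁ d≡1 = d≡1
  ... | inj₂ refl = contradiction d∣b q∤b
... | Bézout.-+ x y 1+xq≡yb = y , (begin
  (y * b) % suc r            ≡⟨ cong (_% suc r) 1+xq≡yb ⟨
  (1 + x * suc r) % suc r    ≡⟨ [m+kn]%n≡m%n 1 x (suc r) ⟩
  1 % suc r                  ∎)
  where open ≡-Reasoning
-- Here y b ≡ -1 (mod q), so (q - 1) y inverts b.
... | Bézout.+- x y 1+yb≡xq = r * y , (begin
  (r * y * b) % suc r                      ≡⟨ [m+kn]%n≡m%n (r * y * b) x (suc r) ⟨
  (r * y * b + x * suc r) % suc r          ≡⟨ cong (λ z → (r * y * b + z) % suc r) 1+yb≡xq ⟨
  (r * y * b + (1 + y * b)) % suc r        ≡⟨ cong (_% suc r) (regroup r y b) ⟩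
  (1 + y * b * suc r) % suc r              ≡⟨ [m+kn]%n≡m%n 1 (y * b) (suc r) ⟩
  1 % suc r                                ∎)
  where
  open ≡-Reasoning
  open +-*-Solver
  regroup : ∀ r y b → r * y * b + (1 + y * b) ≡ 1 + y * b * suc r
  regroup = solve 3 (λ r y b → r :* y :* b :+ (con 1 :+ y :* b) := con 1 :+ y :* b :* (con 1 :+ r)) refl

leastBelow-spec : ∀ m (P : ℕ → Bool) x → x < m → T (P x) → T (P (leastBelow m P))
leastBelow-spec (suc m) P x x<m Px with P 0 in P0
... | true = subst T (sym P0) tt
leastBelow-spec (suc m) P zero x<m Px | false = ⊥-elim (subst T P0 Px)
leastBelow-spec (suc m) P (suc x) (s≤s x<m) Px | false = leastBelow-spec m (P ∘ suc) x x<m Px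

Cong⇒congᵇ : ∀ q a b → Cong q a b → T (congᵇ q a b)
Cong⇒congᵇ q a b q∣a-b with q ∣? ℤ.∣ + a ℤ.- + b ∣
... | yes _ = tt
... | no q∤a-b = q∤a-b q∣a-b

congᵇ⇒Cong : ∀ q a b → T (congᵇ q a b) → Cong q a b
congᵇ⇒Cong q a b _ with q ∣? ℤ.∣ + a ℤ.- + b ∣
... | yes q∣a-b = q∣a-b

bracket-inverse : ∀ {q b} .{{_ : NonZero q}} → Prime q → ¬ q ∣ b → Residues._≋_ q (bracket 1 b q * b) 1
bracket-inverse {q} {b} q-prime q∤b with inverse-mod q-prime q∤b
... | x , xb≋1 = Cong⇒≋ (congᵇ⇒Cong q (bracket 1 b q * b) 1 least-is-inverse)
  where
  open Residues q
  least-is-inverse : T (congᵇ q (bracket 1 b q * b) 1)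
  least-is-inverse = leastBelow-spec q (λ k → congᵇ q (k * b) 1) (x % q) (m%n<n x q)
    (Cong⇒congᵇ q (x % q * b) 1 (≋⇒Cong (trans (≋-* (m%n%n≡m%n x q) refl) xb≋1)))

sumUpTo-nonzero : ∀ k (h : ℕ → ℤ) → sumUpTo k h ≢ + 0 → ∃[ j ] j ≤ k × h j ≢ + 0
sumUpTo-nonzero zero h h₀≢0 = 0 , z≤n , h₀≢0
sumUpTo-nonzero (suc k) h s≢0 with h (suc k) ℤ.≟ + 0
... | no hₖ≢0 = suc k , ≤-refl , hₖ≢0
... | yes hₖ≡0 with sumUpTo-nonzero k h (λ s≡0 → s≢0 (cong₂ ℤ._+_ s≡0 hₖ≡0))
...   | j , j≤k , hⱼ≢0 = j , m≤n⇒m≤1+n j≤k , hⱼ≢0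

⊛-nonzero : ∀ (f g : Series) k → (f ⊛ g) k ≢ + 0 → ∃[ j ] j ≤ k × f j ≢ + 0 × g (k ∸ j) ≢ + 0
⊛-nonzero f g k fg≢0 with sumUpTo-nonzero k (λ j → f j ℤ.* g (k ∸ j)) fg≢0
... | j , j≤k , fg≢0 = j , j≤k , (λ f≡0 → fg≢0 (cong (ℤ._* g (k ∸ j)) f≡0))
                                , (λ g≡0 → fg≢0 (trans (cong (f j ℤ.*_) g≡0) (ℤₚ.*-zeroʳ (f j))))

oneS-nonzero : ∀ m → oneS m ≢ + 0 → m ≡ 0
oneS-nonzero zero _ = refl
oneS-nonzero (suc m) 1≢0 = contradiction refl 1≢0

oneMinusXPow-nonzero : ∀ a m → oneMinusXPow a m ≢ + 0 → m ≡ 0 ⊎ m ≡ a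
oneMinusXPow-nonzero a zero _ = inj₁ refl
oneMinusXPow-nonzero a (suc m) c≢0 with suc m ≡ᵇ a in m≡ᵇa
... | true = inj₂ (≡ᵇ⇒≡ (suc m) a (subst T (sym m≡ᵇa) tt))
... | false = contradiction refl c≢0

geomS-nonzero : ∀ b m → geomS b m ≢ + 0 → b ∣ m
geomS-nonzero b m c≢0 with b ∣? m
... | yes b∣m = b∣m
... | no _ = contradiction refl c≢0

module Supports {n : ℕ} (q : ℕ) .{{_ : NonZero q}} (M : ℕ) (w : Fin n → ℕ) where

  open Residues q

  weight : (Fin n → ℕ) → ℕ
  weight t = sum (λ j → t j * w j)

  weight-+ : ∀ t₁ t₂ → weight (λ j → t₁ j + t₂ j) ≡ weight t₁ + weight t₂
  weight-+ t₁ t₂ = trans (sum-cong-≗ (λ j → *-distribʳ-+ (w j) (t₁ j) (t₂ j))) (∑-distrib-+ (λ j → t₁ j * w j) (λ j → t₂ j * w j))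

  weight-δ : ∀ b → weight (λ j → 𝟙 (b ≟ j)) ≡ w b
  weight-δ b = trans (sum-cong-≗ (λ j → 𝟙-* (b ≟ j) (w j))) (sum-δ-flip b w)

  Expressible : (Fin n → ℕ) → ℕ → Set
  Expressible c m = ∃[ t ] (∀ j → t j ≤ c j) × m ≋ weight t

  SupportedBy : (Fin n → ℕ) → Series → Set
  SupportedBy c f = ∀ m → f m ≢ + 0 → m < M → Expressible c m

  expressible-0 : ∀ c → Expressible c 0
  expressible-0 c = (λ _ → 0) , (λ _ → z≤n) , cong (_% q) (sym (sum-replicate-zero n))

  expressible-≋ : ∀ {c m m′} → m ≋ m′ → Expressible c m′ → Expressible c m
  expressible-≋ m≋m′ (t , t≤c , m′≋) = t , t≤c , trans m≋m′ m′≋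

  expressible-+ : ∀ {c₁ c₂ m₁ m₂} → Expressible c₁ m₁ → Expressible c₂ m₂ →
    Expressible (λ j → c₁ j + c₂ j) (m₁ + m₂)
  expressible-+ (t₁ , t₁≤c₁ , m₁≋) (t₂ , t₂≤c₂ , m₂≋) =
    (λ j → t₁ j + t₂ j) , (λ j → +-mono-≤ (t₁≤c₁ j) (t₂≤c₂ j)) ,
    trans (≋-+ m₁≋ m₂≋) (cong (_% q) (sym (weight-+ t₁ t₂)))

  supportedBy-mono : ∀ {c d f} → (∀ j → c j ≤ d j) → SupportedBy c f → SupportedBy d f
  supportedBy-mono c≤d c-supp m fₘ≢0 m<M with c-supp m fₘ≢0 m<M
  ... | t , t≤c , m≋ = t , (λ j → ≤-trans (t≤c j) (c≤d j)) , m≋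

  oneS-supportedBy : ∀ c → SupportedBy c oneS
  oneS-supportedBy c m 1ₘ≢0 _ rewrite oneS-nonzero m 1ₘ≢0 = expressible-0 c

  ⊛-supportedBy : ∀ {c₁ c₂ f g} → SupportedBy c₁ f → SupportedBy c₂ g →
    SupportedBy (λ j → c₁ j + c₂ j) (f ⊛ g)
  ⊛-supportedBy {f = f} {g} f-supp g-supp m fgₘ≢0 m<M with ⊛-nonzero f g m fgₘ≢0
  ... | j , j≤m , fⱼ≢0 , gₘ₋ⱼ≢0 =
    subst (Expressible _) (m+[n∸m]≡n j≤m)
      (expressible-+ (f-supp j fⱼ≢0 (≤-<-trans j≤m m<M))
                     (g-supp (m ∸ j) gₘ₋ⱼ≢0 (≤-<-trans (m∸n≤m m j) m<M)))

  prodS-supportedBy : ∀ {k} (c : Fin k → Fin n → ℕ) (f : Fin k → Series) →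
    (∀ l → SupportedBy (c l) (f l)) → SupportedBy (λ j → sum (λ l → c l j)) (prodS f)
  prodS-supportedBy {zero} c f _ = oneS-supportedBy _
  prodS-supportedBy {suc k} c f f-supp =
    ⊛-supportedBy (f-supp zero) (prodS-supportedBy (c ∘ suc) (f ∘ suc) (f-supp ∘ suc))

Nᵢ≡p*Nᵢⱼ : ∀ {n} (p : Fin n → ℕ) {i j} → j ≢ i → Nᵢ p i ≡ p j * Nᵢⱼ p i j
Nᵢ≡p*Nᵢⱼ p {i} {j} j≢i = trans (prodℕ-extract _ j) (cong₂ _*_ p-at-j (prodℕ-cong both-removed))
  where
  p-at-j : (if does (j ≟ i) then 1 else p j) ≡ p j
  p-at-j = cong (λ b → if b then 1 else p j) (dec-false (j ≟ i) j≢i)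
  both-removed : ∀ l → (if does (l ≟ j) then 1 else (if does (l ≟ i) then 1 else p l))
                     ≡ (if does (l ≟ i) ∨ does (l ≟ j) then 1 else p l)
  both-removed l with l ≟ j | l ≟ i
  ... | yes _ | yes _ = refl
  ... | yes _ | no _ = refl
  ... | no _ | yes _ = refl
  ... | no _ | no _ = refl

Nᵢⱼ-comm : ∀ {n} (p : Fin n → ℕ) a b → Nᵢⱼ p a b ≡ Nᵢⱼ p b a
Nᵢⱼ-comm p a b = prodℕ-cong (λ l → cong (λ c → if c then 1 else p l) (∨-comm (does (l ≟ a)) (does (l ≟ b))))

p∣Nᵢ : ∀ {n} (p : Fin n → ℕ) {i l} → l ≢ i → p i ∣ Nᵢ p l
p∣Nᵢ p {i} {l} l≢i = subst (_∣ Nᵢ p l) factor-at-i (factor∣prodℕ _ i)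
  where
  factor-at-i : (if does (i ≟ l) then 1 else p i) ≡ p i
  factor-at-i = cong (λ c → if c then 1 else p i) (dec-false (i ≟ l) (l≢i ∘ sym))

p∣Nᵢⱼ : ∀ {n} (p : Fin n → ℕ) {i a b} → a ≢ i → b ≢ i → p i ∣ Nᵢⱼ p a b
p∣Nᵢⱼ p {i} {a} {b} a≢i b≢i = subst (_∣ Nᵢⱼ p a b) factor-at-i (factor∣prodℕ _ i)
  where
  factor-at-i : (if does (i ≟ a) ∨ does (i ≟ b) then 1 else p i) ≡ p i
  factor-at-i = cong₂ (λ c d → if c ∨ d then 1 else p i) (dec-false (i ≟ a) (a≢i ∘ sym)) (dec-false (i ≟ b) (b≢i ∘ sym))

∣∧<⇒≡0 : ∀ {d m} → d ∣ m → m < d → m ≡ 0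
∣∧<⇒≡0 {m = zero} _ _ = refl
∣∧<⇒≡0 {m = suc m} d∣m m<d = contradiction d∣m (>⇒∤ m<d)

𝟙<+𝟙>≤𝟙≢ : ∀ {n} (i j : Fin n) → 𝟙 (i <? j) + 𝟙 (j <? i) ≤ 𝟙 (¬? (j ≟ i))
𝟙<+𝟙>≤𝟙≢ i j with j ≟ i
... | yes refl rewrite 𝟙-false (i <? i) (<-irrefl refl) = z≤n
... | no _ = at-most-one (i <? j) (j <? i)
  where
  at-most-one : (i<?j : Dec (i Fin.< j)) (j<?i : Dec (j Fin.< i)) → 𝟙 i<?j + 𝟙 j<?i ≤ 1
  at-most-one (yes i<j) (yes j<i) = contradiction j<i (<-asym i<j)
  at-most-one (yes _) (no _) = ≤-refl
  at-most-one (no _) j<?i = 𝟙≤1 j<?i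

module ModPᵢ {n} (p : Fin n → ℕ) (p-prime : ∀ j → Prime (p j))
             (p-injective : ∀ j l → p j ≡ p l → j ≡ l) (i : Fin n) where

  instance
    pᵢ≢0 : NonZero (p i)
    pᵢ≢0 = prime⇒nonZero (p-prime i)

  open Residues (p i)
  open Supports (p i) (Nᵢ p i) (Nᵢⱼ p i)

  pᵢ∤pⱼ : ∀ {j} → j ≢ i → ¬ p i ∣ p j
  pᵢ∤pⱼ j≢i pᵢ∣pⱼ = j≢i (sym (p-injective i _ (prime∣prime⇒≡ (p-prime i) (p-prime _) pᵢ∣pⱼ)))

  pᵢ∤Nᵢ : ¬ p i ∣ Nᵢ p i
  pᵢ∤Nᵢ pᵢ∣Nᵢ with prime∣prodℕ _ (p-prime i) pᵢ∣Nᵢ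
  ... | l , pᵢ∣fₗ with l ≟ i
  ...   | yes _ = ¬prime[1] (subst Prime (∣1⇒≡1 pᵢ∣fₗ) (p-prime i))
  ...   | no l≢i = pᵢ∤pⱼ l≢i pᵢ∣fₗ

  Nᵢ⁻¹ : ℕ
  Nᵢ⁻¹ = bracket 1 (Nᵢ p i) (p i)

  pⱼ⁻¹ : Fin n → ℕ
  pⱼ⁻¹ j = bracket 1 (p j) (p i)

  Nᵢⱼ*Nᵢ⁻¹≋pⱼ⁻¹ : ∀ {j} → j ≢ i → Nᵢⱼ p i j * Nᵢ⁻¹ ≋ pⱼ⁻¹ j
  Nᵢⱼ*Nᵢ⁻¹≋pⱼ⁻¹ {j} j≢i = begin
    (Nᵢⱼ p i j * Nᵢ⁻¹) % p i                     ≡⟨ cong (_% p i) (*-identityˡ (Nᵢⱼ p i j * Nᵢ⁻¹)) ⟨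
    (1 * (Nᵢⱼ p i j * Nᵢ⁻¹)) % p i               ≡⟨ ≋-* (bracket-inverse (p-prime i) (pᵢ∤pⱼ j≢i)) refl ⟨
    (pⱼ⁻¹ j * p j * (Nᵢⱼ p i j * Nᵢ⁻¹)) % p i    ≡⟨ cong (_% p i) (regroup (pⱼ⁻¹ j) (p j) (Nᵢⱼ p i j) Nᵢ⁻¹) ⟩
    (pⱼ⁻¹ j * (Nᵢ⁻¹ * (p j * Nᵢⱼ p i j))) % p i  ≡⟨ cong (λ x → (pⱼ⁻¹ j * (Nᵢ⁻¹ * x)) % p i) (Nᵢ≡p*Nᵢⱼ p j≢i) ⟨
    (pⱼ⁻¹ j * (Nᵢ⁻¹ * Nᵢ p i)) % p i             ≡⟨ ≋-* {pⱼ⁻¹ j} refl (bracket-inverse (p-prime i) pᵢ∤Nᵢ) ⟩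
    (pⱼ⁻¹ j * 1) % p i                           ≡⟨ cong (_% p i) (*-identityʳ (pⱼ⁻¹ j)) ⟩
    pⱼ⁻¹ j % p i                                 ∎
    where
    open ≡-Reasoning
    open +-*-Solver
    regroup : ∀ v pⱼ N u → v * pⱼ * (N * u) ≡ v * (u * (pⱼ * N))
    regroup = solve 4 (λ v pⱼ N u → v :* pⱼ :* (N :* u) := v :* (u :* (pⱼ :* N))) refl

  topFactor-supportedBy : SupportedBy (λ _ → 0) (oneMinusXPow (bigN p))
  topFactor-supportedBy m c≢0 m<Nᵢ with oneMinusXPow-nonzero (bigN p) m c≢0
  ... | inj₁ refl = expressible-0 _
  ... | inj₂ refl = contradiction Nᵢ≤N (<⇒≱ m<Nᵢ)
    where
    Nᵢ≤N : Nᵢ p i ≤ bigN p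
    Nᵢ≤N = subst (Nᵢ p i ≤_) (sym (prodℕ-extract p i)) (m≤n*m (Nᵢ p i) (p i))

  geomFactor-supportedBy : ∀ l → SupportedBy (λ _ → 0) (geomS (Nᵢ p l))
  geomFactor-supportedBy l m c≢0 m<Nᵢ with l ≟ i | geomS-nonzero (Nᵢ p l) m c≢0
  ... | yes refl | Nᵢ∣m = subst (Expressible _) (sym (∣∧<⇒≡0 Nᵢ∣m m<Nᵢ)) (expressible-0 _)
  ... | no l≢i | Nₗ∣m = expressible-≋ (∣⇒≋0 (∣-trans (p∣Nᵢ p l≢i) Nₗ∣m)) (expressible-0 _)

  -- How often the factor 1 - x^{N_ab} may use the weight N_ij: once if a < b and {a, b} = {i, j}.
  pairBound : Fin n → Fin n → Fin n → ℕ
  pairBound a b j = (if does (b ≟ j) then (if does (a ≟ i) then 𝟙 (a <? b) else 0) else 0)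
                  + (if does (b ≟ i) then (if does (a ≟ j) then 𝟙 (a <? b) else 0) else 0)

  pairBound-fromᵢ : ∀ {a b} → a ≡ i → a Fin.< b → ∀ j → 𝟙 (b ≟ j) ≤ pairBound a b j
  pairBound-fromᵢ {a} {b} a≡i a<b j = subst (_≤ pairBound a b j) first-term (m≤m+n _ _)
    where
    first-term : (if does (b ≟ j) then (if does (a ≟ i) then 𝟙 (a <? b) else 0) else 0) ≡ 𝟙 (b ≟ j)
    first-term rewrite dec-true (a ≟ i) a≡i | 𝟙-true (a <? b) a<b = refl

  pairBound-toᵢ : ∀ {a b} → b ≡ i → a Fin.< b → ∀ j → 𝟙 (a ≟ j) ≤ pairBound a b j
  pairBound-toᵢ {a} {b} b≡i a<b j = subst (_≤ pairBound a b j) second-term (m≤n+m _ _)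
    where
    second-term : (if does (b ≟ i) then (if does (a ≟ j) then 𝟙 (a <? b) else 0) else 0) ≡ 𝟙 (a ≟ j)
    second-term rewrite dec-true (b ≟ i) b≡i | 𝟙-true (a <? b) a<b = refl

  pairBound-total : ∀ j → sum (λ a → sum (λ b → pairBound a b j)) ≡ 𝟙 (i <? j) + 𝟙 (j <? i)
  pairBound-total j = begin
    sum (λ a → sum (λ b → pairBound a b j))
      ≡⟨ sum-cong-≗ (λ a → trans (∑-distrib-+ (first a) (second a)) (cong₂ _+_ (sum-δ j _) (sum-δ i _))) ⟩
    sum (λ a → (if does (a ≟ i) then 𝟙 (a <? j) else 0) + (if does (a ≟ j) then 𝟙 (a <? i) else 0))
      ≡⟨ ∑-distrib-+ (λ a → if does (a ≟ i) then 𝟙 (a <? j) else 0) (λ a → if does (a ≟ j) then 𝟙 (a <? i) else 0) ⟩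
    sum (λ a → if does (a ≟ i) then 𝟙 (a <? j) else 0) + sum (λ a → if does (a ≟ j) then 𝟙 (a <? i) else 0)
      ≡⟨ cong₂ _+_ (sum-δ i _) (sum-δ j _) ⟩
    𝟙 (i <? j) + 𝟙 (j <? i) ∎
    where
    open ≡-Reasoning
    first second : Fin n → Fin n → ℕ
    first a b = if does (b ≟ j) then (if does (a ≟ i) then 𝟙 (a <? b) else 0) else 0
    second a b = if does (b ≟ i) then (if does (a ≟ j) then 𝟙 (a <? b) else 0) else 0

  Nᵢⱼ-expressible : ∀ {a b} → a Fin.< b → Expressible (pairBound a b) (Nᵢⱼ p a b)
  Nᵢⱼ-expressible {a} {b} a<b = by-cases (a ≟ i) (b ≟ i)
    where
    by-cases : Dec (a ≡ i) → Dec (b ≡ i) → Expressible (pairBound a b) (Nᵢⱼ p a b)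
    by-cases (yes a≡i) _ = (λ j → 𝟙 (b ≟ j)) , pairBound-fromᵢ a≡i a<b ,
      cong (_% p i) (trans (cong (λ x → Nᵢⱼ p x b) a≡i) (sym (weight-δ b)))
    by-cases (no _) (yes b≡i) = (λ j → 𝟙 (a ≟ j)) , pairBound-toᵢ b≡i a<b ,
      cong (_% p i) (trans (Nᵢⱼ-comm p a b) (trans (cong (λ x → Nᵢⱼ p x a) b≡i) (sym (weight-δ a))))
    by-cases (no a≢i) (no b≢i) = expressible-≋ (∣⇒≋0 (p∣Nᵢⱼ p a≢i b≢i)) (expressible-0 _)

  pairFactor-supportedBy : ∀ a b →
    SupportedBy (pairBound a b) (if does (a <? b) then oneMinusXPow (Nᵢⱼ p a b) else oneS)
  pairFactor-supportedBy a b = by-cases (a <? b)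
    where
    by-cases : (a<?b : Dec (a Fin.< b)) →
      SupportedBy (pairBound a b) (if does a<?b then oneMinusXPow (Nᵢⱼ p a b) else oneS)
    by-cases (no _) = oneS-supportedBy _
    by-cases (yes a<b) m c≢0 _ with oneMinusXPow-nonzero (Nᵢⱼ p a b) m c≢0
    ... | inj₁ refl = expressible-0 _
    ... | inj₂ refl = Nᵢⱼ-expressible a<b

  PN-supportedBy : SupportedBy (λ j → 𝟙 (¬? (j ≟ i))) (PN p)
  PN-supportedBy = supportedBy-mono total-bound
    (⊛-supportedBy topFactor-supportedBy
      (⊛-supportedBy (prodS-supportedBy _ _ (λ a → prodS-supportedBy _ _ (pairFactor-supportedBy a)))
                     (prodS-supportedBy _ _ geomFactor-supportedBy)))
    where
    total-bound : ∀ j → sum (λ a → sum (λ b → pairBound a b j)) + sum {n} (λ _ → 0) ≤ 𝟙 (¬? (j ≟ i))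
    total-bound j = begin
      sum (λ a → sum (λ b → pairBound a b j)) + sum {n} (λ _ → 0)  ≡⟨ cong₂ _+_ (pairBound-total j) (sum-replicate-zero n) ⟩
      𝟙 (i <? j) + 𝟙 (j <? i) + 0                                 ≡⟨ +-identityʳ _ ⟩
      𝟙 (i <? j) + 𝟙 (j <? i)                                     ≤⟨ 𝟙<+𝟙>≤𝟙≢ i j ⟩
      𝟙 (¬? (j ≟ i))                                              ∎
      where open ≤-Reasoning

  support : (Fin n → ℕ) → Subset n
  support t = tabulate (λ j → t j ≡ᵇ 1)

  i∉support : ∀ t → t i ≡ 0 → i ∉ support t
  i∉support t tᵢ≡0 i∈support
    with subst (λ x → (x ≡ᵇ 1) ≡ true) tᵢ≡0 (trans (sym (lookup∘tabulate (λ l → t l ≡ᵇ 1) i)) ([]=⇒lookup i∈support))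
  ... | ()

  inverse-in : Subset n → Fin n → ℕ
  inverse-in T j = if lookup T j then pⱼ⁻¹ j else 0

  summand≋ : ∀ {j} x → x ≤ 𝟙 (¬? (j ≟ i)) → x * Nᵢⱼ p i j * Nᵢ⁻¹ ≋ (if x ≡ᵇ 1 then pⱼ⁻¹ j else 0)
  summand≋ zero _ = refl
  summand≋ {j} (suc zero) 1≤ = trans (cong (λ z → (z * Nᵢ⁻¹) % p i) (*-identityˡ (Nᵢⱼ p i j)))
                                     (Nᵢⱼ*Nᵢ⁻¹≋pⱼ⁻¹ (𝟙-witness (¬? (j ≟ i)) 1≤))
  summand≋ {j} (suc (suc x)) 2≤ = contradiction (≤-trans 2≤ (𝟙≤1 (¬? (j ≟ i)))) λ { (s≤s ()) }

  subset-sum-of-expressible : ∀ {k} → Expressible (λ j → 𝟙 (¬? (j ≟ i))) k →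
    ∃[ T ] i ∉ T × Cong (p i) (k * Nᵢ⁻¹) (sumℕ (inverse-in T))
  subset-sum-of-expressible {k} (t , t≤c , k≋) = support t , i∉support t tᵢ≡0 , ≋⇒Cong (begin
    (k * Nᵢ⁻¹) % p i                                  ≡⟨ ≋-* k≋ (refl {x = Nᵢ⁻¹ % p i}) ⟩
    (weight t * Nᵢ⁻¹) % p i                           ≡⟨ cong (_% p i) (*-distribʳ-sum Nᵢ⁻¹ (λ j → t j * Nᵢⱼ p i j)) ⟩
    sum (λ j → t j * Nᵢⱼ p i j * Nᵢ⁻¹) % p i          ≡⟨ ≋-sum (λ j → summand≋ (t j) (t≤c j)) ⟩
    sum (λ j → if t j ≡ᵇ 1 then pⱼ⁻¹ j else 0) % p i  ≡⟨ cong (_% p i) (sum-cong-≗ in-support) ⟨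
    sum (inverse-in (support t)) % p i                ≡⟨ cong (_% p i) (sumℕ≡sum (inverse-in (support t))) ⟨
    sumℕ (inverse-in (support t)) % p i               ∎)
    where
    open ≡-Reasoning
    tᵢ≡0 : t i ≡ 0
    tᵢ≡0 = n≤0⇒n≡0 (subst (t i ≤_) (𝟙-false (¬? (i ≟ i)) (λ i≢i → i≢i refl)) (t≤c i))
    in-support : ∀ j → inverse-in (support t) j ≡ (if t j ≡ᵇ 1 then pⱼ⁻¹ j else 0)
    in-support j = cong (λ c → if c then pⱼ⁻¹ j else 0) (lookup∘tabulate (λ l → t l ≡ᵇ 1) j)

mainTheorem15 : (n : ℕ) → 2 ≤ n → (p : Fin n → ℕ) → (∀ j → Prime (p j))
    → (∀ j l → p j ≡ p l → j ≡ l)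
    → (∀ m → bigN p ≤ m → PN p m ≡ + 0)
    → (i : Fin n) → (k : ℕ) → 0 < k → k < Nᵢ p i
    → (∀ (T : Subset n) → i ∉ T
        → ¬ Cong (p i) (k * bracket 1 (Nᵢ p i) (p i))
                 (sumℕ (λ j → if lookup T j then bracket 1 (p j) (p i) else 0)))
    → PN p k ≡ + 0
mainTheorem15 n _ p p-prime p-injective _ i k _ k<Nᵢ no-subset-sum = coefficient-vanishes (PN p k ℤ.≟ + 0)
  where
  open ModPᵢ p p-prime p-injective i
  coefficient-vanishes : Dec (PN p k ≡ + 0) → PN p k ≡ + 0
  coefficient-vanishes (yes coefficient≡0) = coefficient≡0
  coefficient-vanishes (no coefficient≢0) =
    let T , i∉T , congruent = subset-sum-of-expressible (PN-supportedBy k coefficient≢0 k<Nᵢ)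
    in ⊥-elim (no-subset-sum T i∉T congruent)
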